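{- Let $(\Gamma,+,<)$ be an ordered Abelian group, $S_0,\ldots,S_{n-1}\subseteq\Gamma^{>0}$ well ordered subsets, and $U\subseteq\Gamma$ a segment of $\Gamma$. Then there are finite segmentations $\mathcal S_i$ of $S_i$ ($i<n$) such that $\bigotimes_{i<n}\mathcal S_i$ refines the partition of $\prod_{i<n}S_i$ generated by $(\prod_{i<n}S_i)\cap\Sigma^{ -1}(U)$.
   Context: $\Sigma:\bigcup_n\Gamma^n\to\Gamma$ is $\Sigma((x_i)_{i<n})=\sum_{i<n}x_i$. A segment is an order-convex subset; a segmentation is a partition into segments. $\bigotimes_i\mathcal S_i=\{\prod_iA_i: A_i\in\mathcal S_i\}$. The partition of a set $Y$ generated by a subset $X\subseteq Y$ is $\{X,Y\setminus X\}$ with empty members removed; a partition $\mathcal Q$ refines $\mathcal P$ if every member of $\mathcal P$ is a union of members of $\mathcal Q$. -}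

module Defs where

open import Level using (0ℓ) renaming (suc to lsuc)
open import Data.Nat using (ℕ; zero; suc)
open import Data.Fin using (Fin; zero; suc)
open import Data.Product using (Σ; ∃; _×_; _,_)
open import Data.Sum using (_⊎_)
open import Relation.Nullary using (¬_)
open import Relation.Unary using (Pred; _∈_; _⊆_; _∩_)
open import Relation.Binary using (Rel; IsStrictTotalOrder)
open import Relation.Binary.PropositionalEquality using (_≡_; _≢_)
open import Algebra.Core using (Op₁; Op₂)
open import Algebra.Structures using (IsAbelianGroup)

record OrderedAbelianGroup : Set₁ where
  infixl 6 _+_
  infix 4 _<_
  field
    Carrier            : Set
    _+_                : Op₂ Carrier
    0#                 : Carrier
    -_                 : Op₁ Carrier
    _<_                : Rel Carrier 0ℓ
    isAbelianGroup     : IsAbelianGroup _≡_ _+_ 0# -_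
    isStrictTotalOrder : IsStrictTotalOrder _≡_ _<_
    +-mono-<           : ∀ z {x y} → x < y → x + z < y + z

module _ (G : OrderedAbelianGroup) where
  open OrderedAbelianGroup G

  Subset : Set₁
  Subset = Pred Carrier 0ℓ

  _≤_ : Carrier → Carrier → Set
  x ≤ y = x < y ⊎ x ≡ y

  Positive : Subset → Set
  Positive S = ∀ {x} → x ∈ S → 0# < x

  WellOrdered : Subset → Set₁
  WellOrdered S = ∀ (T : Subset) → T ⊆ S → (∃ λ x → x ∈ T) →
                  ∃ λ m → m ∈ T × (∀ {y} → y ∈ T → m ≤ y)

  IsSegmentOf : Subset → Subset → Set
  IsSegmentOf X A = A ⊆ X ×
    (∀ {x y z} → x ∈ A → y ∈ X → z ∈ A → x < y → y < z → y ∈ A)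

  IsSegment : Subset → Set
  IsSegment A = ∀ {x y z} → x ∈ A → z ∈ A → x < y → y < z → y ∈ A

  IsSegmentation : (X : Subset) {k : ℕ} → (Fin k → Subset) → Set
  IsSegmentation X {k} A =
    (∀ j → IsSegmentOf X (A j)) ×
    (∀ j → ∃ λ x → x ∈ A j) ×
    (∀ j j' → j ≢ j' → ∀ {x} → x ∈ A j → x ∈ A j' → ⊥') ×
    (∀ {x} → x ∈ X → ∃ λ j → x ∈ A j)
    where open import Data.Empty renaming (⊥ to ⊥')

  Σ' : ∀ {n} → (Fin n → Carrier) → Carrier
  Σ' {zero}  x = 0#
  Σ' {suc n} x = x zero + Σ' {n} (λ i → x (suc i))

  ∏ : ∀ {n} → (Fin n → Subset) → Pred (Fin n → Carrier) 0ℓ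
  ∏ S x = ∀ i → x i ∈ S i

  Σ⁻¹ : ∀ {n} → Subset → Pred (Fin n → Carrier) 0ℓ
  Σ⁻¹ U x = Σ' x ∈ U

module _ {A : Set} where

  _≐_ : Pred A 0ℓ → Pred A 0ℓ → Set
  M ≐ N = M ⊆ N × N ⊆ M

  _∖_ : Pred A 0ℓ → Pred A 0ℓ → Pred A 0ℓ
  (Y ∖ X) a = a ∈ Y × ¬ (a ∈ X)

  Nonempty : Pred A 0ℓ → Set
  Nonempty X = ∃ λ a → a ∈ X

  -- M is a member of the partition of Y generated by X, i.e. of
  -- {X, Y ∖ X} with empty members removed
  GeneratedMember : (Y X : Pred A 0ℓ) → Pred A 0ℓ → Set
  GeneratedMember Y X M = (Nonempty X × M ≐ X) ⊎ (Nonempty (Y ∖ X) × M ≐ (Y ∖ X))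

  Refines : {I : Set} → (I → Pred A 0ℓ) → (Pred A 0ℓ → Set) → Set₁
  Refines {I} Q IsMember = ∀ M → IsMember M →
    Σ (I → Set) λ J → M ≐ (λ a → ∃ λ i → J i × a ∈ Q i)

⨂ : (G : OrderedAbelianGroup) → ∀ {n} {k : Fin n → ℕ} →
    ((i : Fin n) → Fin (k i) → Subset G) →
    ((i : Fin n) → Fin (k i)) → Pred (Fin n → OrderedAbelianGroup.Carrier G) 0ℓ
⨂ G 𝒮 j = ∏ G (λ i → 𝒮 i (j i))

{-# OPTIONS --safe #-}
-- With respect to the product order, the tuples a ∈ ∏ Sᵢ with Σ a above some
-- point of U and those with Σ a strictly above all of U form two upper sets,
-- and since U is a segment, Σ a ∈ U exactly when a lies in the first but not
-- in the second. By Dickson's lemma each of them is generated by finitely many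
-- tuples. Cutting every Sᵢ at the i-th coordinates of these generators yields
-- finite segmentations, and two tuples in the same box lie above the same
-- generators, hence on the same side of Σ⁻¹(U).
module Submission where

open import Defs hiding (_≤_)
open import Level using (0ℓ)
open import Data.Nat using (ℕ; zero; suc; z≤n; s≤s)
import Data.Nat as ℕ
import Data.Nat.Properties as ℕₚ
open import Data.Fin using (Fin; zero; suc)
open import Data.Product using (Σ; ∃; _×_; _,_; proj₁; proj₂)
open import Data.Sum using (_⊎_; inj₁; inj₂)
open import Data.Unit using (⊤; tt)
open import Data.Empty using (⊥; ⊥-elim)
open import Data.List using (List; []; _∷_; _++_; map; length; lookup; filter)
open import Data.List.Relation.Unary.All as All using (All; []; _∷_)
open import Data.List.Relation.Unary.All.Properties using (++⁺)
open import Data.List.Relation.Unary.Any as Any using (Any; here; there)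
open import Data.List.Relation.Unary.Any.Properties using (++⁺ˡ; ++⁺ʳ; lookup-index)
open import Data.List.Relation.Unary.AllPairs using (_∷_)
open import Data.List.Relation.Unary.Unique.Propositional using (Unique)
open import Data.List.Relation.Unary.Unique.Propositional.Properties using (filter⁺; upTo⁺)
open import Data.List.Membership.Propositional using (find) renaming (_∈_ to _∈ˡ_)
open import Data.List.Membership.Propositional.Properties
  using (∈-filter⁺; ∈-filter⁻; ∈-lookup; ∈-upTo⁺; ∈-map⁺; ∈-++⁺ˡ; ∈-++⁺ʳ)
open import Data.Vec.Functional using (Vector; head; tail)
open import Data.Vec.Functional.Relation.Binary.Pointwise using (Pointwise)
open import Function using (_∘_)
open import Function.Definitions using (Injective)
open import Relation.Nullary using (¬_; Dec; yes; no; contradiction)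
open import Relation.Unary using (Pred; Decidable; _∈_; _∉_; _⊆_; _∩_)
open import Relation.Binary using (IsStrictTotalOrder; tri<; tri≈; tri>)
open import Relation.Binary.PropositionalEquality
  using (_≡_; refl; sym; trans; cong; subst; subst₂; isEquivalence)
import Relation.Binary.Construct.StrictToNonStrict as StrictToNonStrict
open import Algebra.Structures using (IsAbelianGroup)
open import Axiom.ExcludedMiddle using (ExcludedMiddle)

module _ {A : Set} where

  lookup-injective : {xs : List A} → Unique xs → Injective _≡_ _≡_ (lookup xs)
  lookup-injective (_ ∷ _)    {zero}  {zero}  _  = refl
  lookup-injective (x∉xs ∷ _) {zero}  {suc j} eq =
    contradiction eq (All.lookup x∉xs (∈-lookup j))
  lookup-injective (x∉xs ∷ _) {suc i} {zero}  eq =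
    contradiction (sym eq) (All.lookup x∉xs (∈-lookup i))
  lookup-injective (_ ∷ xs!)  {suc i} {suc j} eq = cong suc (lookup-injective xs! eq)

  record Enumeration (P : Pred A 0ℓ) (xs : List A) : Set where
    field
      size            : ℕ
      entry           : Fin size → A
      entry-injective : Injective _≡_ _≡_ entry
      entry∈P         : ∀ j → entry j ∈ P
      complete        : ∀ {x} → x ∈ˡ xs → x ∈ P → ∃ λ j → entry j ≡ x

  enumerate-filter : ExcludedMiddle 0ℓ → (P : Pred A 0ℓ) {xs : List A} → Unique xs →
    Enumeration P xs
  enumerate-filter lem P {xs} xs! = record
    { size            = length ys
    ; entry           = lookup ys
    ; entry-injective = lookup-injective (filter⁺ P? xs!)
    ; entry∈P         = λ j → proj₂ (∈-filter⁻ P? {xs = xs} (∈-lookup j))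
    ; complete        = λ x∈xs x∈P →
        let x∈ys = ∈-filter⁺ P? x∈xs x∈P in Any.index x∈ys , sym (lookup-index x∈ys)
    }
    where
      P? : Decidable P
      P? x = lem {x ∈ P}

      ys : List A
      ys = filter P? xs

module _ {A : Set} {Y X : Pred A 0ℓ} where

  generatedMember⊆ : ∀ {M} → X ⊆ Y → GeneratedMember Y X M → M ⊆ Y
  generatedMember⊆ X⊆Y (inj₁ (_ , M⊆X , _))    = X⊆Y ∘ M⊆X
  generatedMember⊆ X⊆Y (inj₂ (_ , M⊆Y∖X , _)) = proj₁ ∘ M⊆Y∖X

  module _ {I : Set} {Q : I → Pred A 0ℓ} where

    saturated⇒⊆generatedMember : (∀ i → Q i ⊆ Y) →
      (∀ i {a b} → a ∈ Q i → b ∈ Q i → a ∈ X → b ∈ X) →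
      ∀ {M} → GeneratedMember Y X M → ∀ {i a} → a ∈ Q i → a ∈ M → Q i ⊆ M
    saturated⇒⊆generatedMember _ saturated (inj₁ (_ , M⊆X , X⊆M)) a∈Qi a∈M b∈Qi =
      X⊆M (saturated _ a∈Qi b∈Qi (M⊆X a∈M))
    saturated⇒⊆generatedMember Q⊆Y saturated (inj₂ (_ , M⊆Y∖X , Y∖X⊆M)) a∈Qi a∈M b∈Qi =
      Y∖X⊆M (Q⊆Y _ b∈Qi , λ b∈X → proj₂ (M⊆Y∖X a∈M) (saturated _ b∈Qi a∈Qi b∈X))

    refines-generated : X ⊆ Y → (∀ i → Q i ⊆ Y) → (∀ {a} → a ∈ Y → ∃ λ i → a ∈ Q i) →
      (∀ i {a b} → a ∈ Q i → b ∈ Q i → a ∈ X → b ∈ X) →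
      Refines Q (GeneratedMember Y X)
    refines-generated X⊆Y Q⊆Y covers saturated M member =
      (λ i → Q i ⊆ M) , M⊆⋃ , λ (_ , Qi⊆M , a∈Qi) → Qi⊆M a∈Qi
      where
        M⊆⋃ : ∀ {a} → a ∈ M → ∃ λ i → Q i ⊆ M × a ∈ Q i
        M⊆⋃ a∈M with i , a∈Qi ← covers (generatedMember⊆ X⊆Y member a∈M) =
          i , saturated⇒⊆generatedMember Q⊆Y saturated member a∈Qi a∈M , a∈Qi

module OrderedAbelianGroupProperties (G : OrderedAbelianGroup) where

  open OrderedAbelianGroup G renaming (Carrier to Γ)
  open IsAbelianGroup isAbelianGroup using (comm)
  open IsStrictTotalOrder isStrictTotalOrder using (compare; <-resp-≈)
  open IsStrictTotalOrder isStrictTotalOrder using ()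
    renaming (trans to <-trans; irrefl to <-irrefl) public
  private
    module NonStrict = StrictToNonStrict _≡_ _<_

  infix 4 _≤_ _≤ⁿ_

  _≤_ : Γ → Γ → Set
  _≤_ = Defs._≤_ G

  ≤-refl : ∀ {x} → x ≤ x
  ≤-refl = NonStrict.reflexive refl

  ≤-trans : ∀ {x y z} → x ≤ y → y ≤ z → x ≤ z
  ≤-trans = NonStrict.trans isEquivalence <-resp-≈ <-trans

  <⇒≤ : ∀ {x y} → x < y → x ≤ y
  <⇒≤ = NonStrict.<⇒≤

  <-≤-trans : ∀ {x y z} → x < y → y ≤ z → x < z
  <-≤-trans = NonStrict.<-≤-trans <-trans (proj₁ <-resp-≈)

  ≤⇒≯ : ∀ {x y} → x ≤ y → ¬ y < x
  ≤⇒≯ x≤y y<x = <-irrefl refl (NonStrict.≤-<-trans sym <-trans (proj₂ <-resp-≈) x≤y y<x)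

  _≤?_ : ∀ x y → Dec (x ≤ y)
  _≤?_ = NonStrict.decidable′ compare

  <⊎≥ : ∀ x y → x < y ⊎ y ≤ x
  <⊎≥ x y with compare x y
  ... | tri< x<y _ _ = inj₁ x<y
  ... | tri≈ _ x≡y _ = inj₂ (inj₂ (sym x≡y))
  ... | tri> _ _ y<x = inj₂ (inj₁ y<x)

  +-monoˡ-≤ : ∀ z {x y} → x ≤ y → x + z ≤ y + z
  +-monoˡ-≤ z (inj₁ x<y)  = inj₁ (+-mono-< z x<y)
  +-monoˡ-≤ z (inj₂ refl) = ≤-refl

  +-mono-≤ : ∀ {x y u v} → x ≤ y → u ≤ v → x + u ≤ y + v
  +-mono-≤ {x} {y} {u} {v} x≤y u≤v =
    ≤-trans (+-monoˡ-≤ u x≤y) (subst₂ _≤_ (comm u y) (comm v y) (+-monoˡ-≤ y u≤v))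

  segment-≤-closed : ∀ {U} → IsSegment G U → ∀ {u v w} → u ∈ U → w ∈ U → u ≤ v → v ≤ w → v ∈ U
  segment-≤-closed _     u∈U _   (inj₂ refl) _           = u∈U
  segment-≤-closed _     _   w∈U (inj₁ _)    (inj₂ refl) = w∈U
  segment-≤-closed U-seg u∈U w∈U (inj₁ u<v)  (inj₁ v<w)  = U-seg u∈U w∈U u<v v<w

  IsUpperSet : Subset G → Set
  IsUpperSet V = ∀ {x y} → x ∈ V → x ≤ y → y ∈ V

  AtOrAbove : Subset G → Subset G
  AtOrAbove U v = ∃ λ u → u ∈ U × u ≤ v

  StrictlyAbove : Subset G → Subset G
  StrictlyAbove U v = ∀ {u} → u ∈ U → u < v

  AtOrAbove-isUpperSet : ∀ {U} → IsUpperSet (AtOrAbove U)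
  AtOrAbove-isUpperSet (u , u∈U , u≤x) x≤y = u , u∈U , ≤-trans u≤x x≤y

  StrictlyAbove-isUpperSet : ∀ {U} → IsUpperSet (StrictlyAbove U)
  StrictlyAbove-isUpperSet U<x x≤y u∈U = <-≤-trans (U<x u∈U) x≤y

  rank : List Γ → Γ → ℕ
  rank []       x = 0
  rank (c ∷ cs) x with c ≤? x
  ... | yes _ = suc (rank cs x)
  ... | no _  = rank cs x

  rank-bounded : ∀ cs x → rank cs x ℕ.< suc (length cs)
  rank-bounded []       x = s≤s z≤n
  rank-bounded (c ∷ cs) x with c ≤? x
  ... | yes _ = s≤s (rank-bounded cs x)
  ... | no _  = ℕₚ.m<n⇒m<1+n (rank-bounded cs x)

  rank-mono : ∀ cs {x y} → x ≤ y → rank cs x ℕ.≤ rank cs y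
  rank-mono []       _ = z≤n
  rank-mono (c ∷ cs) {x} {y} x≤y with c ≤? x | c ≤? y
  ... | yes _   | yes _   = s≤s (rank-mono cs x≤y)
  ... | yes c≤x | no c≰y  = contradiction (≤-trans c≤x x≤y) c≰y
  ... | no _    | yes _   = ℕₚ.m≤n⇒m≤1+n (rank-mono cs x≤y)
  ... | no _    | no _    = rank-mono cs x≤y

  rank-strict : ∀ cs {c x y} → c ∈ˡ cs → y < c → c ≤ x → rank cs y ℕ.< rank cs x
  rank-strict (c ∷ cs) {x = x} {y} (here refl) y<c c≤x with c ≤? y | c ≤? x
  ... | yes c≤y | _       = contradiction y<c (≤⇒≯ c≤y)
  ... | no _    | yes _   = s≤s (rank-mono cs (<⇒≤ (<-≤-trans y<c c≤x)))
  ... | no _    | no c≰x  = contradiction c≤x c≰x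
  rank-strict (c′ ∷ cs) {x = x} {y} (there c∈cs) y<c c≤x with c′ ≤? y | c′ ≤? x
  ... | yes _    | yes _   = s≤s (rank-strict cs c∈cs y<c c≤x)
  ... | yes c′≤y | no c′≰x = contradiction (≤-trans c′≤y (<⇒≤ (<-≤-trans y<c c≤x))) c′≰x
  ... | no _     | yes _   = ℕₚ.m<n⇒m<1+n (rank-strict cs c∈cs y<c c≤x)
  ... | no _     | no _    = rank-strict cs c∈cs y<c c≤x

  rank-≡⇒≤ : ∀ cs {c x y} → rank cs x ≡ rank cs y → c ∈ˡ cs → c ≤ x → c ≤ y
  rank-≡⇒≤ cs {c} {x} {y} rank≡ c∈cs c≤x with <⊎≥ y c
  ... | inj₁ y<c = contradiction (sym rank≡) (ℕₚ.<⇒≢ (rank-strict cs c∈cs y<c c≤x))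
  ... | inj₂ c≤y = c≤y

  Fibre : Subset G → (Γ → ℕ) → ℕ → Subset G
  Fibre S f r x = x ∈ S × f x ≡ r

  Tuple : ℕ → Set
  Tuple = Vector Γ

  _≤ⁿ_ : ∀ {n} → Tuple n → Tuple n → Set
  _≤ⁿ_ = Pointwise _≤_

  ≤ⁿ-refl : ∀ {n} {a : Tuple n} → a ≤ⁿ a
  ≤ⁿ-refl _ = ≤-refl

  ≤ⁿ-trans : ∀ {n} {a b c : Tuple n} → a ≤ⁿ b → b ≤ⁿ c → a ≤ⁿ c
  ≤ⁿ-trans a≤b b≤c i = ≤-trans (a≤b i) (b≤c i)

  ≤ⁿ-head-tail : ∀ {n} {a b : Tuple (suc n)} → head a ≤ head b → tail a ≤ⁿ tail b → a ≤ⁿ b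
  ≤ⁿ-head-tail a₀≤b₀ _    zero    = a₀≤b₀
  ≤ⁿ-head-tail _     a≤b (suc i) = a≤b i

  Σ'-mono : ∀ {n} {a b : Tuple n} → a ≤ⁿ b → Σ' G a ≤ Σ' G b
  Σ'-mono {zero}  _   = ≤-refl
  Σ'-mono {suc n} a≤b = +-mono-≤ (a≤b zero) (Σ'-mono (a≤b ∘ suc))

  module _ {n : ℕ} {k : Fin n → ℕ} {S : Fin n → Subset G}
           {𝒮 : (i : Fin n) → Fin (k i) → Subset G}
           (segmentation : ∀ i → IsSegmentation G (S i) (𝒮 i)) where

    ⨂⊆∏ : ∀ j → ⨂ G 𝒮 j ⊆ ∏ G S
    ⨂⊆∏ j a∈ i = proj₁ (proj₁ (segmentation i) (j i)) (a∈ i)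

    ∏⊆⋃⨂ : ∀ {a} → a ∈ ∏ G S → ∃ λ j → a ∈ ⨂ G 𝒮 j
    ∏⊆⋃⨂ {a} a∈ = (λ i → proj₁ (covers i)) , λ i → proj₂ (covers i)
      where
        covers : ∀ i → ∃ λ j → a i ∈ 𝒮 i j
        covers i = proj₂ (proj₂ (proj₂ (segmentation i))) (a∈ i)

  record IsUpperSetOf {n} (X B : Pred (Tuple n) 0ℓ) : Set where
    field
      B⊆X    : B ⊆ X
      upward : ∀ {a b} → a ∈ B → b ∈ X → a ≤ⁿ b → b ∈ B

  ↑_ : ∀ {n} → List (Tuple n) → Pred (Tuple n) 0ℓ
  (↑ hs) b = Any (_≤ⁿ b) hs

  record FiniteBasis {n} (B : Pred (Tuple n) 0ℓ) : Set where
    constructor finiteBasis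
    field
      basis    : List (Tuple n)
      basis⊆B  : All (_∈ B) basis
      B⊆↑basis : B ⊆ ↑ basis

  _≲[_]_ : ∀ {n} → Tuple n → List (Tuple n) → Tuple n → Set
  a ≲[ hs ] b = ∀ {h} → h ∈ˡ hs → h ≤ⁿ a → h ≤ⁿ b

  basis-determines : ∀ {n} {X B : Pred (Tuple n) 0ℓ} → IsUpperSetOf X B →
    (B-basis : FiniteBasis B) → ∀ {a b} →
    a ∈ B → b ∈ X → a ≲[ FiniteBasis.basis B-basis ] b → b ∈ B
  basis-determines B↑ (finiteBasis hs hs⊆B B⊆↑hs) a∈B b∈X a≲b
    with h , h∈hs , h≤a ← find (B⊆↑hs a∈B) =
    IsUpperSetOf.upward B↑ (All.lookup hs⊆B h∈hs) b∈X (a≲b h∈hs h≤a)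

  Σ⁻¹-isUpperSetOf : ∀ {n} {S : Fin n → Subset G} {V} → IsUpperSet V →
    IsUpperSetOf (∏ G S) (∏ G S ∩ Σ⁻¹ G V)
  Σ⁻¹-isUpperSetOf V↑ = record
    { B⊆X    = proj₁
    ; upward = λ (_ , Σa∈V) b∈ a≤b → b∈ , V↑ Σa∈V (Σ'-mono a≤b)
    }

  sameRanks⇒≲ : ∀ {n} (gs : List (Tuple n)) {a b : Tuple n} →
    (∀ i → rank (map (λ g → g i) gs) (a i) ≡ rank (map (λ g → g i) gs) (b i)) →
    a ≲[ gs ] b
  sameRanks⇒≲ gs sameRanks g∈gs g≤a i =
    rank-≡⇒≤ (map (λ g → g i) gs) (sameRanks i) (∈-map⁺ (λ g → g i) g∈gs) (g≤a i)

module Classical (lem : ExcludedMiddle 0ℓ) (G : OrderedAbelianGroup) where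

  open OrderedAbelianGroup G renaming (Carrier to Γ)
  open OrderedAbelianGroupProperties G

  monotone-fibres-segmentation : (S : Subset G) {f : Γ → ℕ} {m : ℕ} →
    (∀ x → f x ℕ.< m) → (∀ {x y} → x ≤ y → f x ℕ.≤ f y) →
    ∃ λ k → Σ (Fin k → ℕ) λ e → IsSegmentation G S (λ j → Fibre S f (e j))
  monotone-fibres-segmentation S {f} {m} f<m f-mono =
    size , entry , (λ _ → proj₁ , convex) , entry∈P , disjoint , covers
    where
      open Enumeration (enumerate-filter lem (λ r → ∃ λ x → x ∈ Fibre S f r) (upTo⁺ m))

      convex : ∀ {r x y z} → x ∈ Fibre S f r → y ∈ S → z ∈ Fibre S f r → x < y → y < z →
               y ∈ Fibre S f r
      convex (_ , refl) y∈S (_ , fz≡fx) x<y y<z =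
        y∈S , ℕₚ.≤-antisym (subst (f _ ℕ.≤_) fz≡fx (f-mono (<⇒≤ y<z))) (f-mono (<⇒≤ x<y))

      disjoint : ∀ j j′ → ¬ j ≡ j′ → ∀ {x} →
        x ∈ Fibre S f (entry j) → x ∈ Fibre S f (entry j′) → ⊥
      disjoint j j′ j≢j′ (_ , fx≡ej) (_ , fx≡ej′) =
        j≢j′ (entry-injective (trans (sym fx≡ej) fx≡ej′))

      covers : ∀ {x} → x ∈ S → ∃ λ j → x ∈ Fibre S f (entry j)
      covers {x} x∈S with j , ej≡fx ← complete (∈-upTo⁺ (f<m x)) (x , x∈S , refl) =
        j , x∈S , sym ej≡fx

  ∈-segment : ∀ {U} → IsSegment G U → ∀ {v} → v ∈ AtOrAbove U → v ∉ StrictlyAbove U → v ∈ U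
  ∈-segment {U} U-seg {v} (u , u∈U , u≤v) v∉U< with lem {∃ λ w → w ∈ U × v ≤ w}
  ... | yes (w , w∈U , v≤w) = segment-≤-closed U-seg u∈U w∈U u≤v v≤w
  ... | no ∄w = ⊥-elim (v∉U< below)
    where
      below : ∀ {w} → w ∈ U → w < v
      below {w} w∈U with <⊎≥ w v
      ... | inj₁ w<v = w<v
      ... | inj₂ v≤w = contradiction (w , w∈U , v≤w) ∄w

  wellOrdered-induction : ∀ {S : Subset G} → WellOrdered G S → {P : Γ → Set} →
    (∀ {x} → x ∈ S → (∀ {y} → y ∈ S → y < x → P y) → P x) →
    ∀ {x} → x ∈ S → P x
  wellOrdered-induction {S} wo {P} step {x} x∈S with lem {P x}
  ... | yes Px = Px
  ... | no ¬Px with wo (λ y → y ∈ S × ¬ P y) proj₁ (x , x∈S , ¬Px)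
  ...   | m , (m∈S , ¬Pm) , minimal = contradiction (step m∈S below) ¬Pm
    where
      below : ∀ {y} → y ∈ S → y < m → P y
      below {y} y∈S y<m with lem {P y}
      ... | yes Py  = Py
      ... | no ¬Py = contradiction y<m (≤⇒≯ (minimal (y∈S , ¬Py)))

  -- A basis element g of the tails comes from some a with tail a ≤ⁿ g; then a,
  -- together with a basis of the part of B with head below head a, covers every
  -- b ∈ B whose tail lies above g.
  headRestricted-basis : ∀ {n} {S : Fin (suc n) → Subset G} {B : Pred (Tuple (suc n)) 0ℓ}
    {W : Subset G} →
    (∀ {C} → IsUpperSetOf (∏ G (tail S)) C → FiniteBasis C) →
    IsUpperSetOf (∏ G S) B →
    (∀ {x y} → x ∈ S zero → x < y → y ∈ W → x ∈ W) →
    (∀ {w} → w ∈ W → w ∈ S zero → FiniteBasis (B ∩ (_< w) ∘ head)) →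
    FiniteBasis (B ∩ W ∘ head)
  headRestricted-basis {n} {S} {B} {W} tail-basis B↑ W-down below =
    let hs , hs⊆ , hs-covers = liftTailBasis TailBasis.basis TailBasis.basis⊆B
    in finiteBasis hs hs⊆ λ b∈ → hs-covers b∈ (TailBasis.B⊆↑basis (tail∈Tails b∈))
    where
      open IsUpperSetOf B↑

      Tails : Pred (Tuple n) 0ℓ
      Tails p = p ∈ ∏ G (tail S) × ∃ λ a → a ∈ B ∩ W ∘ head × tail a ≤ⁿ p

      Tails↑ : IsUpperSetOf (∏ G (tail S)) Tails
      Tails↑ = record
        { B⊆X    = proj₁
        ; upward = λ (_ , a , a∈ , a≤p) q∈ p≤q → q∈ , a , a∈ , ≤ⁿ-trans a≤p p≤q
        }

      tail∈Tails : ∀ {a} → a ∈ B ∩ W ∘ head → tail a ∈ Tails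
      tail∈Tails a∈@(a∈B , _) = B⊆X a∈B ∘ suc , _ , a∈ , ≤ⁿ-refl

      module TailBasis = FiniteBasis (tail-basis Tails↑)

      liftTailBasis : ∀ gs → All (_∈ Tails) gs →
        Σ (List (Tuple (suc n))) λ hs → All (_∈ B ∩ W ∘ head) hs ×
          (∀ {b} → b ∈ B ∩ W ∘ head → tail b ∈ ↑ gs → b ∈ ↑ hs)
      liftTailBasis []       []                             = [] , [] , λ _ ()
      liftTailBasis (g ∷ gs) ((_ , a , a∈@(a∈B , a₀∈W) , a≤g) ∷ gs⊆)
        with hs , hs⊆ , hs-covers ← liftTailBasis gs gs⊆ =
        a ∷ basis ++ hs , a∈ ∷ ++⁺ (All.map below⊆W basis⊆B) hs⊆ , covers
        where
          open FiniteBasis (below a₀∈W (B⊆X a∈B zero))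

          below⊆W : ∀ {b} → b ∈ B ∩ (_< head a) ∘ head → b ∈ B ∩ W ∘ head
          below⊆W (b∈B , b₀<a₀) = b∈B , W-down (B⊆X b∈B zero) b₀<a₀ a₀∈W

          covers : ∀ {b} → b ∈ B ∩ W ∘ head → tail b ∈ ↑ (g ∷ gs) → b ∈ ↑ (a ∷ basis ++ hs)
          covers {b} (b∈B , _) (here g≤b) with <⊎≥ (head b) (head a)
          ... | inj₁ b₀<a₀ = there (++⁺ˡ (B⊆↑basis (b∈B , b₀<a₀)))
          ... | inj₂ a₀≤b₀ = here (≤ⁿ-head-tail a₀≤b₀ (≤ⁿ-trans a≤g g≤b))
          covers b∈ (there b∈↑gs) = there (++⁺ʳ basis (hs-covers b∈ b∈↑gs))

  dickson : ∀ n {S : Fin n → Subset G} {B : Pred (Tuple n) 0ℓ} →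
    (∀ i → WellOrdered G (S i)) → IsUpperSetOf (∏ G S) B → FiniteBasis B
  dickson zero {B = B} _ _ with lem {∃ λ a → a ∈ B}
  ... | yes (a , a∈B) = finiteBasis (a ∷ []) (a∈B ∷ []) λ _ → here λ ()
  ... | no ∄a         = finiteBasis [] [] λ b∈B → contradiction (_ , b∈B) ∄a
  dickson (suc n) {S} {B} wo B↑ =
    let finiteBasis hs hs⊆ B⊆↑hs =
          headRestricted-basis {S = S} {W = λ _ → ⊤} tail-basis B↑ (λ _ _ _ → tt) λ _ → below
    in finiteBasis hs (All.map proj₁ hs⊆) λ b∈B → B⊆↑hs (b∈B , tt)
    where
      tail-basis : ∀ {C} → IsUpperSetOf (∏ G (tail S)) C → FiniteBasis C
      tail-basis = dickson n (wo ∘ suc)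

      below : ∀ {w} → w ∈ S zero → FiniteBasis (B ∩ (_< w) ∘ head)
      below = wellOrdered-induction (wo zero) λ _ smaller →
        headRestricted-basis {S = S} tail-basis B↑ (λ _ x<y y<w → <-trans x<y y<w)
          λ y<w y∈S → smaller y∈S y<w

  rank-segmentation : (S : Subset G) (cs : List Γ) →
    ∃ λ k → Σ (Fin k → ℕ) λ e → IsSegmentation G S (λ j → Fibre S (rank cs) (e j))
  rank-segmentation S cs = monotone-fibres-segmentation S (rank-bounded cs) (rank-mono cs)

  module _ {n} {S : Fin n → Subset G} (wo : ∀ i → WellOrdered G (S i)) (U : Subset G) where

    reachesU↑ : IsUpperSetOf (∏ G S) (∏ G S ∩ Σ⁻¹ G (AtOrAbove U))
    reachesU↑ = Σ⁻¹-isUpperSetOf {S = S} AtOrAbove-isUpperSet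

    exceedsU↑ : IsUpperSetOf (∏ G S) (∏ G S ∩ Σ⁻¹ G (StrictlyAbove U))
    exceedsU↑ = Σ⁻¹-isUpperSetOf {S = S} StrictlyAbove-isUpperSet

    reachesU-basis : FiniteBasis (∏ G S ∩ Σ⁻¹ G (AtOrAbove U))
    reachesU-basis = dickson n wo reachesU↑

    exceedsU-basis : FiniteBasis (∏ G S ∩ Σ⁻¹ G (StrictlyAbove U))
    exceedsU-basis = dickson n wo exceedsU↑

    sum-generators : List (Tuple n)
    sum-generators = FiniteBasis.basis reachesU-basis ++ FiniteBasis.basis exceedsU-basis

    sum∈segment-determined : IsSegment G U → ∀ {a b} → a ∈ ∏ G S → b ∈ ∏ G S →
      a ≲[ sum-generators ] b → b ≲[ sum-generators ] a → Σ' G a ∈ U → Σ' G b ∈ U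
    sum∈segment-determined U-seg {a} {b} a∈ b∈ a≲b b≲a Σa∈U =
      ∈-segment U-seg Σb-reaches Σb-not-above
      where
        Σb-reaches : Σ' G b ∈ AtOrAbove U
        Σb-reaches = proj₂ (basis-determines reachesU↑ reachesU-basis
          (a∈ , _ , Σa∈U , ≤-refl) b∈ λ h∈ → a≲b (∈-++⁺ˡ h∈))

        Σb-not-above : Σ' G b ∉ StrictlyAbove U
        Σb-not-above Σb-above = <-irrefl refl (proj₂ (basis-determines exceedsU↑ exceedsU-basis
          (b∈ , Σb-above) a∈ λ h∈ → b≲a (∈-++⁺ʳ _ h∈)) Σa∈U)

corollary2p10 : ExcludedMiddle 0ℓ →
    (G : OrderedAbelianGroup) (n : ℕ) (S : Fin n → Subset G) →
    (∀ i → Positive G (S i)) → (∀ i → WellOrdered G (S i)) →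
    (U : Subset G) → IsSegment G U →
    Σ (Fin n → ℕ) λ k →
    Σ ((i : Fin n) → Fin (k i) → Subset G) λ 𝒮 →
      (∀ i → IsSegmentation G (S i) (𝒮 i)) ×
      Refines (⨂ G 𝒮) (GeneratedMember (∏ G S) (∏ G S ∩ Σ⁻¹ G U))
corollary2p10 lem G n S _ wo U U-segment =
  k , 𝒮 , segmentation ,
  refines-generated proj₁ (⨂⊆∏ segmentation) (∏⊆⋃⨂ segmentation) sameBox⇒sameSide
  where
    open OrderedAbelianGroupProperties G
    open Classical lem G

    gs : List (Tuple n)
    gs = sum-generators wo U

    cuts : Fin n → List (OrderedAbelianGroup.Carrier G)
    cuts i = map (λ g → g i) gs

    k : Fin n → ℕ
    k i = proj₁ (rank-segmentation (S i) (cuts i))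

    𝒮 : (i : Fin n) → Fin (k i) → Subset G
    𝒮 i j = Fibre (S i) (rank (cuts i)) (proj₁ (proj₂ (rank-segmentation (S i) (cuts i))) j)

    segmentation : ∀ i → IsSegmentation G (S i) (𝒮 i)
    segmentation i = proj₂ (proj₂ (rank-segmentation (S i) (cuts i)))

    sameBox⇒sameSide : ∀ j {a b} → a ∈ ⨂ G 𝒮 j → b ∈ ⨂ G 𝒮 j →
      a ∈ ∏ G S ∩ Σ⁻¹ G U → b ∈ ∏ G S ∩ Σ⁻¹ G U
    sameBox⇒sameSide j {a} {b} a∈ b∈ (a∈∏ , Σa∈U) =
      b∈∏ , sum∈segment-determined wo U U-segment a∈∏ b∈∏
              (sameRanks⇒≲ gs sameRanks) (sameRanks⇒≲ gs (sym ∘ sameRanks)) Σa∈U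
      where
        b∈∏ : b ∈ ∏ G S
        b∈∏ = ⨂⊆∏ segmentation j b∈

        sameRanks : ∀ i → rank (cuts i) (a i) ≡ rank (cuts i) (b i)
        sameRanks i = trans (proj₂ (a∈ i)) (sym (proj₂ (b∈ i)))
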